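{- For any integer $n\ge0$, any $k\in\mathcal K$ and any $s<s'$ in $S$: (1) if $n$ is odd, then $m^{(s'),\dagger}_{n+1}(k)-m^{(s'),\dagger}_n(k)\ge m^{(s),\dagger}_{n+1}(k)-m^{(s),\dagger}_n(k)$; (2) if $n$ is even, then $m^{(s'),\dagger}_{n+1}(k)-m^{(s'),\dagger}_n(k)\le m^{(s),\dagger}_{n+1}(k)-m^{(s),\dagger}_n(k)$.
   Context: Let $p\ge7$ be prime, $k_0\in\{2,\dots,p\}$, $\mathcal K=\{k\ge2:k\equiv k_0\pmod{p-1}\}$, $k_\bullet=(k-k_0)/(p-1)$, $\{n\}\in\{0,\dots,p-2\}$ the residue mod $p-1$. For $s\in\{0,\dots,p-2\}$: $a_s=\{k_0-2-2s\}$; $\delta_s=0$ if $s+\{a_s+s\}<p-1$, else $1$; if $a_s+s<p-1$, $t_1^{(s)}=s+\delta_s$, $t_2^{(s)}=a_s+s+\delta_s+2$; otherwise $t_1^{(s)}=\{a_s+s\}+\delta_s+1$, $t_2^{(s)}=s+\delta_s+1$. $d^{\mathrm{ur},\dagger}_k(s)=\lfloor\frac{k_\bullet-t_1^{(s)}}{p+1}\rfloor+\lfloor\frac{k_\bullet-t_2^{(s)}}{p+1}\rfloor+2+\delta_s$, $d^{\mathrm{Iw},\dagger}_k=2k_\bullet+2$, and $m^{(s),\dagger}_n(k)=\min\{n-d^{\mathrm{ur},\dagger}_k(s),d^{\mathrm{Iw},\dagger}_k-d^{\mathrm{ur},\dagger}_k(s)-n\}$ if $d^{\mathrm{ur},\dagger}_k(s)<n<d^{\mathrm{Iw},\dagger}_k-d^{\mathrm{ur},\dagger}_k(s)$,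 and $0$ otherwise. $S=\{\lceil\frac{k_0+1}2\rceil,\dots,\lfloor\frac{k_0-4+p}2\rfloor\}$. -}

module Defs where

open import Data.Nat as ℕ using (ℕ; zero; suc)
open import Data.Integer as ℤ using (ℤ; +_; _+_; _-_; _*_; _<?_; _⊓_)
open import Data.Integer.DivMod using (_/ℕ_; _%ℕ_)
open import Data.Bool using (Bool; if_then_else_; _∧_)
open import Relation.Nullary.Decidable using (⌊_⌋)

-- Floor division of an integer by a natural number d (d = 0 gives 0; never used).
fdiv : ℤ → ℕ → ℤ
fdiv x zero    = + 0
fdiv x (suc d) = x /ℕ (suc d)

res : ℤ → ℕ → ℕ
res x zero    = 0
res x (suc d) = x %ℕ (suc d)

-- All definitions below are for prime p and k₀ ∈ {2,…,p}, with s ∈ {0,…,p-2}.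
module _ (p k₀ : ℕ) where

  ⟪_⟫ : ℤ → ℕ
  ⟪ x ⟫ = res x (p ℕ.∸ 1)

  kBullet : ℤ → ℤ
  kBullet k = fdiv (k - + k₀) (p ℕ.∸ 1)

  a : ℕ → ℕ
  a s = ⟪ + k₀ - + 2 - + (2 ℕ.* s) ⟫

  δ : ℕ → ℕ
  δ s = if ⌊ (s ℕ.+ ⟪ + (a s ℕ.+ s) ⟫) ℕ.<? (p ℕ.∸ 1) ⌋ then 0 else 1

  t₁ : ℕ → ℕ
  t₁ s = if ⌊ (a s ℕ.+ s) ℕ.<? (p ℕ.∸ 1) ⌋
           then s ℕ.+ δ s
           else ⟪ + (a s ℕ.+ s) ⟫ ℕ.+ δ s ℕ.+ 1

  t₂ : ℕ → ℕ
  t₂ s = if ⌊ (a s ℕ.+ s) ℕ.<? (p ℕ.∸ 1) ⌋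
           then a s ℕ.+ s ℕ.+ δ s ℕ.+ 2
           else s ℕ.+ δ s ℕ.+ 1

  dUr : ℤ → ℕ → ℤ
  dUr k s = fdiv (kBullet k - + t₁ s) (suc p)
          + fdiv (kBullet k - + t₂ s) (suc p)
          + + 2 + + δ s

  dIw : ℤ → ℤ
  dIw k = + 2 * kBullet k + + 2

  m : ℕ → ℤ → ℕ → ℤ
  m s k n =
    if ⌊ dUr k s <? + n ⌋ ∧ ⌊ + n <? dIw k - dUr k s ⌋
      then (+ n - dUr k s) ⊓ (dIw k - dUr k s - + n)
      else + 0

  -- S = {⌈(k₀+1)/2⌉, …, ⌊(k₀-4+p)/2⌋}
  Smin : ℕ
  Smin = (k₀ ℕ.+ 2) ℕ./ 2

  Smax : ℕ
  Smax = (k₀ ℕ.+ p ℕ.∸ 4) ℕ./ 2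

module Submission where

-- For s ∈ S one has a_s = k₀ − 2 − 2s + (p − 1), and in both branches of the definition of
-- t₁, t₂ the number d^{ur,†}_k(s) collapses to ⌊X/(p+1)⌋ + ⌊Y/(p+1)⌋ + 2 with
-- X = k_• − (s + 1) and Y = k_• − k₀ + (s + 1). For s < s′ in S these arguments satisfy
-- X′ ≤ X ≤ Y ≤ Y′ < X′ + p + 1, so the floors u ≤ v ≤ w ≤ z satisfy z ≤ u + 1, and therefore
-- either d(s′) = d(s), or d(s′) is odd and d(s) = d(s′) ± 1. On the other side
-- m_n = max(d, min(n, W − n)) − d with W = d^{Iw,†}_k even, so m_{n+1} − m_n is [d ≤ n] on the
-- ascending half and −[d ≤ W − n − 1] on the descending half; the threshold has the parity
-- of n in the first case and the opposite parity in the second, which gives both inequalities.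

open import Data.Bool using (_∧_; if_then_else_)
open import Data.Integer hiding (suc)
open import Data.Integer.DivMod using (_/ℕ_; _%ℕ_; [n/ℕd]*d≤n; n<s[n/ℕd]*d; a≡a%ℕn+[a/ℕn]*n)
open import Data.Integer.Divisibility using () renaming (_∣_ to _∣ℤ_)
open import Data.Integer.Properties
open import Data.Integer.Tactic.RingSolver using (solve-∀)
open import Data.Nat as ℕ using (ℕ; zero; suc; z≤n; s≤s)
import Data.Nat.DivMod as ℕ
import Data.Nat.Properties as ℕ
open import Data.Nat.Primality using (Prime)
open import Data.Product using (_×_; _,_)
open import Data.Sum using ([_,_]′)
open import Relation.Binary.PropositionalEquality
open import Relation.Nullary using (Dec; yes; no; ¬_; contradiction)
open import Relation.Nullary.Decidable using (⌊_⌋; toSum)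

open import Defs

-- Linear arithmetic by certificate: y − x is exhibited as a sum of slacks, an identity checked by the ring solver.
≤-via : ∀ {a b} x y (c : ℕ) → a ≤ b → y ≡ x + (b - a) + + c → x ≤ y
≤-via {a} {b} x y c a≤b refl = begin
  x                   ≡⟨ +-identityʳ x ⟨
  x + 0ℤ              ≤⟨ +-monoʳ-≤ x (+-mono-≤ (i≤j⇒0≤j-i a≤b) (+≤+ z≤n)) ⟩
  x + ((b - a) + + c) ≡⟨ +-assoc x (b - a) (+ c) ⟨
  x + (b - a) + + c   ∎
  where open ≤-Reasoning

≤-via₂ : ∀ {a b a′ b′} x y (c : ℕ) → a ≤ b → a′ ≤ b′ → y ≡ x + (b - a) + (b′ - a′) + + c → x ≤ y
≤-via₂ {a} {b} {a′} {b′} x y c a≤b a′≤b′ refl =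
  ≤-via x y c (+-mono-≤ a≤b a′≤b′) (lemma x a b a′ b′ (+ c))
  where lemma : ∀ x a b a′ b′ c → x + (b - a) + (b′ - a′) + c ≡ x + (b + b′ - (a + a′)) + c
        lemma = solve-∀

<-via : ∀ {a b} x y (c : ℕ) → a ≤ b → y ≡ 1ℤ + x + (b - a) + + c → x < y
<-via x y c a≤b eq = suc[i]≤j⇒i<j (≤-via (1ℤ + x) y c a≤b eq)

<-suc⇒≤ : ∀ {a b} → a < 1ℤ + b → a ≤ b
<-suc⇒≤ {a} {b} a<1+b = subst (a ≤_) (pred-suc b) (i<j⇒i≤pred[j] a<1+b)

2*-≤-2*+1⇒≤ : ∀ a b → + 2 * a ≤ + 2 * b + 1ℤ → a ≤ b
2*-≤-2*+1⇒≤ a b 2a≤2b+1 = <-suc⇒≤ (*-cancelˡ-<-nonNeg (+ 2) (<-via _ _ 0 2a≤2b+1 (lemma a b)))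
  where lemma : ∀ a b → + 2 * (1ℤ + b) ≡ 1ℤ + + 2 * a + (+ 2 * b + 1ℤ - + 2 * a) + + 0
        lemma = solve-∀

module _ (d : ℕ) .{{_ : ℕ.NonZero d}} where

  /ℕ-unique : ∀ {z} f → f * + d ≤ z → z < (1ℤ + f) * + d → z /ℕ d ≡ f
  /ℕ-unique {z} f fd≤z z<[1+f]d = ≤-antisym
    (<-suc⇒≤ (*-cancelʳ-<-nonNeg (+ d) (≤-<-trans ([n/ℕd]*d≤n z d) z<[1+f]d)))
    (<-suc⇒≤ (*-cancelʳ-<-nonNeg (+ d) (≤-<-trans fd≤z (n<s[n/ℕd]*d z d))))

  %ℕ-unique : ∀ {z} f → f * + d ≤ z → z < (1ℤ + f) * + d → + (z %ℕ d) ≡ z - f * + d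
  %ℕ-unique {z} f fd≤z z<[1+f]d = begin
    + (z %ℕ d)
      ≡⟨ lemma (+ (z %ℕ d)) (z /ℕ d * + d) ⟩
    + (z %ℕ d) + z /ℕ d * + d - z /ℕ d * + d
      ≡⟨ cong₂ (λ x y → x - y * + d) (sym (a≡a%ℕn+[a/ℕn]*n z d)) (/ℕ-unique f fd≤z z<[1+f]d) ⟩
    z - f * + d
      ∎
    where open ≡-Reasoning
          lemma : ∀ r x → r ≡ r + x - x
          lemma = solve-∀

  /ℕ-mono-≤ : ∀ {z w} → z ≤ w → z /ℕ d ≤ w /ℕ d
  /ℕ-mono-≤ {z} {w} z≤w = <-suc⇒≤ (*-cancelʳ-<-nonNeg (+ d)
    (≤-<-trans ([n/ℕd]*d≤n z d) (≤-<-trans z≤w (n<s[n/ℕd]*d w d))))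

  /ℕ-≤-suc : ∀ {z w} → w < z + + d → w /ℕ d ≤ 1ℤ + z /ℕ d
  /ℕ-≤-suc {z} {w} w<z+d = <-suc⇒≤ (*-cancelʳ-<-nonNeg (+ d)
    (≤-<-trans ([n/ℕd]*d≤n w d) (<-trans w<z+d
      (<-≤-trans (+-monoˡ-< (+ d) (n<s[n/ℕd]*d z d)) (≤-reflexive (lemma (z /ℕ d) (+ d)))))))
    where lemma : ∀ q d → (1ℤ + q) * d + d ≡ (1ℤ + (1ℤ + q)) * d
          lemma = solve-∀

  [z-d]/ℕd≡z/ℕd-1 : ∀ z → (z - + d) /ℕ d ≡ z /ℕ d - 1ℤ
  [z-d]/ℕd≡z/ℕd-1 z = /ℕ-unique (z /ℕ d - 1ℤ)
    (≤-via _ _ 0 ([n/ℕd]*d≤n z d) (lemma₁ z (z /ℕ d) (+ d)))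
    (<-≤-trans (+-monoˡ-< (- + d) (n<s[n/ℕd]*d z d)) (≤-reflexive (lemma₂ (z /ℕ d) (+ d))))
    where lemma₁ : ∀ z q d → z - d ≡ (q - 1ℤ) * d + (z - q * d) + + 0
          lemma₁ = solve-∀
          lemma₂ : ∀ q d → (1ℤ + q) * d - d ≡ (1ℤ + (q - 1ℤ)) * d
          lemma₂ = solve-∀

tent : ℤ → ℤ → ℤ
tent W x = x ⊓ (W - x)

tent-left : ∀ {W x} → + 2 * x ≤ W → tent W x ≡ x
tent-left {W} {x} 2x≤W = i≤j⇒i⊓j≡i (≤-via _ _ 0 2x≤W (lemma x W))
  where lemma : ∀ x W → W - x ≡ x + (W - + 2 * x) + + 0
        lemma = solve-∀

tent-right : ∀ {W x} → W ≤ + 2 * x → tent W x ≡ W - x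
tent-right {W} {x} W≤2x = i≥j⇒i⊓j≡j (≤-via _ _ 0 W≤2x (lemma x W))
  where lemma : ∀ x W → x ≡ W - x + (+ 2 * x - W) + + 0
        lemma = solve-∀

-- m p k₀ s k n unfolds to tentExcess (dUr p k₀ k s) (dIw p k₀ k) n.
tentExcess : ℤ → ℤ → ℕ → ℤ
tentExcess d W n =
  if ⌊ d <? + n ⌋ ∧ ⌊ + n <? W - d ⌋ then (+ n - d) ⊓ (W - d - + n) else + 0

excess-≤ : ∀ {d x} → x ≤ d → d ⊔ x - d ≡ 0ℤ
excess-≤ {d} x≤d = trans (cong (_- d) (i≥j⇒i⊔j≡i x≤d)) (+-inverseʳ d)

tentExcess≡ : ∀ d W n → tentExcess d W n ≡ d ⊔ tent W (+ n) - d
tentExcess≡ d W n with d <? + n | + n <? W - d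
... | yes d<n | yes n<W-d = begin
  (+ n - d) ⊓ (W - d - + n)   ≡⟨ cong ((+ n - d) ⊓_) (lemma W d (+ n)) ⟩
  (+ n - d) ⊓ (W - + n - d)   ≡⟨ mono-<-distrib-⊓ (_- d) (+-monoˡ-< (- d)) (+ n) (W - + n) ⟨
  tent W (+ n) - d            ≡⟨ cong (_- d) (i≤j⇒i⊔j≡j (<⇒≤ d<tent)) ⟨
  d ⊔ tent W (+ n) - d        ∎
  where
    open ≡-Reasoning
    lemma : ∀ W d n → W - d - n ≡ W - n - d
    lemma = solve-∀
    d<tent : d < tent W (+ n)
    d<tent = suc[i]≤j⇒i<j (⊓-glb (i<j⇒suc[i]≤j d<n) (≤-via _ _ 0 (i<j⇒suc[i]≤j n<W-d) (lemma′ W d (+ n))))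
      where lemma′ : ∀ W d n → W - n ≡ 1ℤ + d + (W - d - (1ℤ + n)) + + 0
            lemma′ = solve-∀
... | no d≮n | _ = sym (excess-≤ (≤-trans (i⊓j≤i (+ n) (W - + n)) (≮⇒≥ d≮n)))
... | yes _ | no n≮W-d = sym (excess-≤ (≤-trans (i⊓j≤j (+ n) (W - + n)) W-n≤d))
  where
    W-n≤d : W - + n ≤ d
    W-n≤d = ≤-via _ _ 0 (≮⇒≥ n≮W-d) (lemma W d (+ n))
      where lemma : ∀ W d n → d ≡ W - n + (n - (W - d)) + + 0
            lemma = solve-∀

rise : ℤ → ℤ → ℤ
rise d h = (d ⊔ (1ℤ + h)) - (d ⊔ h)

rise-≤ : ∀ {d h} → d ≤ h → rise d h ≡ 1ℤ
rise-≤ {d} {h} d≤h = begin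
  (d ⊔ (1ℤ + h)) - (d ⊔ h)  ≡⟨ cong₂ _-_ (i≤j⇒i⊔j≡j (≤-trans d≤h (i≤suc[i] h))) (i≤j⇒i⊔j≡j d≤h) ⟩
  (1ℤ + h) - h              ≡⟨ lemma h ⟩
  1ℤ                        ∎
  where
    open ≡-Reasoning
    lemma : ∀ h → (1ℤ + h) - h ≡ 1ℤ
    lemma = solve-∀

rise-> : ∀ {d h} → h < d → rise d h ≡ 0ℤ
rise-> {d} {h} h<d = begin
  (d ⊔ (1ℤ + h)) - (d ⊔ h)  ≡⟨ cong₂ _-_ (i≥j⇒i⊔j≡i (i<j⇒suc[i]≤j h<d)) (i≥j⇒i⊔j≡i (<⇒≤ h<d)) ⟩
  d - d                     ≡⟨ +-inverseʳ d ⟩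
  0ℤ                        ∎
  where open ≡-Reasoning

rise-nonNeg : ∀ d h → 0ℤ ≤ rise d h
rise-nonNeg d h = i≤j⇒0≤j-i (⊔-monoʳ-≤ d (i≤suc[i] h))

rise-mono : ∀ {d d′} h → (d ≤ h → d′ ≤ h) → rise d h ≤ rise d′ h
rise-mono {d} {d′} h d≤h⇒d′≤h with d ≤? h
... | yes d≤h = ≤-reflexive (trans (rise-≤ d≤h) (sym (rise-≤ (d≤h⇒d′≤h d≤h))))
... | no d≰h = subst (_≤ rise d′ h) (sym (rise-> (≰⇒> d≰h))) (rise-nonNeg d′ h)

tentExcessΔ : ℤ → ℤ → ℕ → ℤ
tentExcessΔ d W n = tentExcess d W (suc n) - tentExcess d W n

tentExcessΔ≡ : ∀ d W n → tentExcessΔ d W n ≡ (d ⊔ tent W (1ℤ + + n)) - (d ⊔ tent W (+ n))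
tentExcessΔ≡ d W n = begin
  tentExcess d W (suc n) - tentExcess d W n             ≡⟨ cong₂ _-_ (tentExcess≡ d W (suc n)) (tentExcess≡ d W n) ⟩
  (d ⊔ tent W (1ℤ + + n) - d) - (d ⊔ tent W (+ n) - d)  ≡⟨ lemma (d ⊔ tent W (1ℤ + + n)) (d ⊔ tent W (+ n)) d ⟩
  (d ⊔ tent W (1ℤ + + n)) - (d ⊔ tent W (+ n))          ∎
  where
    open ≡-Reasoning
    lemma : ∀ a b d → (a - d) - (b - d) ≡ a - b
    lemma = solve-∀

tentExcessΔ-ascending : ∀ d W n → + 2 * (1ℤ + + n) ≤ W → tentExcessΔ d W n ≡ rise d (+ n)
tentExcessΔ-ascending d W n 2[n+1]≤W = begin
  tentExcessΔ d W n                             ≡⟨ tentExcessΔ≡ d W n ⟩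
  (d ⊔ tent W (1ℤ + + n)) - (d ⊔ tent W (+ n))  ≡⟨ cong₂ (λ x y → (d ⊔ x) - (d ⊔ y)) (tent-left 2[n+1]≤W) (tent-left 2n≤W) ⟩
  rise d (+ n)                                  ∎
  where
    open ≡-Reasoning
    2n≤W : + 2 * + n ≤ W
    2n≤W = ≤-trans (*-monoˡ-≤-nonNeg (+ 2) (i≤suc[i] (+ n))) 2[n+1]≤W

tentExcessΔ-descending : ∀ d W n → W ≤ + 2 * + n → tentExcessΔ d W n ≡ - rise d (W - (1ℤ + + n))
tentExcessΔ-descending d W n W≤2n = begin
  tentExcessΔ d W n
    ≡⟨ tentExcessΔ≡ d W n ⟩
  (d ⊔ tent W (1ℤ + + n)) - (d ⊔ tent W (+ n))
    ≡⟨ cong₂ (λ x y → (d ⊔ x) - (d ⊔ y)) (tent-right W≤2[n+1]) (trans (tent-right W≤2n) (lemma₁ W (+ n))) ⟩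
  (d ⊔ h) - (d ⊔ (1ℤ + h))
    ≡⟨ lemma₂ (d ⊔ h) (d ⊔ (1ℤ + h)) ⟩
  - rise d h
    ∎
  where
    open ≡-Reasoning
    h : ℤ
    h = W - (1ℤ + + n)
    W≤2[n+1] : W ≤ + 2 * (1ℤ + + n)
    W≤2[n+1] = ≤-trans W≤2n (*-monoˡ-≤-nonNeg (+ 2) (i≤suc[i] (+ n)))
    lemma₁ : ∀ W n → W - n ≡ 1ℤ + (W - (1ℤ + n))
    lemma₁ = solve-∀
    lemma₂ : ∀ a b → a - b ≡ - (b - a)
    lemma₂ = solve-∀

-- Holds exactly when d′ = d, or d′ is odd and d = d′ ± 1.
record OddAdjacent (d d′ : ℤ) : Set where
  field
    odd-≤  : ∀ i → d ≤ + 2 * i + 1ℤ → d′ ≤ + 2 * i + 1ℤ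
    even-≤ : ∀ i → d′ ≤ + 2 * i → d ≤ + 2 * i

module _ {d d′ : ℤ} (adj : OddAdjacent d d′) where
  open OddAdjacent adj

  rise-odd : ∀ {h} i → h ≡ + 2 * i + 1ℤ → rise d h ≤ rise d′ h
  rise-odd i refl = rise-mono _ (odd-≤ i)

  rise-even : ∀ {h} i → h ≡ + 2 * i → rise d′ h ≤ rise d h
  rise-even i refl = rise-mono _ (even-≤ i)

odd⇒≡2i+1 : ∀ n → n ℕ.% 2 ≡ 1 → + n ≡ + 2 * + (n ℕ./ 2) + 1ℤ
odd⇒≡2i+1 n odd = trans (cong +_ (begin
  n                          ≡⟨ ℕ.m≡m%n+[m/n]*n n 2 ⟩
  n ℕ.% 2 ℕ.+ n ℕ./ 2 ℕ.* 2  ≡⟨ cong₂ ℕ._+_ odd (ℕ.*-comm (n ℕ./ 2) 2) ⟩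
  1 ℕ.+ 2 ℕ.* (n ℕ./ 2)      ≡⟨ ℕ.+-comm 1 _ ⟩
  2 ℕ.* (n ℕ./ 2) ℕ.+ 1      ∎)) (trans (pos-+ _ 1) (cong (_+ 1ℤ) (pos-* 2 (n ℕ./ 2))))
  where open ≡-Reasoning

even⇒≡2i : ∀ n → n ℕ.% 2 ≡ 0 → + n ≡ + 2 * + (n ℕ./ 2)
even⇒≡2i n even = trans (cong +_ (begin
  n                          ≡⟨ ℕ.m≡m%n+[m/n]*n n 2 ⟩
  n ℕ.% 2 ℕ.+ n ℕ./ 2 ℕ.* 2  ≡⟨ cong₂ ℕ._+_ even (ℕ.*-comm (n ℕ./ 2) 2) ⟩
  2 ℕ.* (n ℕ./ 2)            ∎)) (pos-* 2 (n ℕ./ 2))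
  where open ≡-Reasoning

tentExcessΔ-compare : ∀ {d d′} c n → OddAdjacent d d′ →
  (n ℕ.% 2 ≡ 1 → tentExcessΔ d (+ 2 * c + + 2) n ≤ tentExcessΔ d′ (+ 2 * c + + 2) n) ×
  (n ℕ.% 2 ≡ 0 → tentExcessΔ d′ (+ 2 * c + + 2) n ≤ tentExcessΔ d (+ 2 * c + + 2) n)
tentExcessΔ-compare {d} {d′} c n adj with + n <? c + 1ℤ
... | yes n<c+1 =
  (λ odd → subst₂ _≤_ (sym (asc d)) (sym (asc d′)) (rise-odd adj i (odd⇒≡2i+1 n odd))) ,
  (λ even → subst₂ _≤_ (sym (asc d′)) (sym (asc d)) (rise-even adj i (even⇒≡2i n even)))
  where
    W i : ℤ
    W = + 2 * c + + 2
    i = + (n ℕ./ 2)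
    2[n+1]≤W : + 2 * (1ℤ + + n) ≤ W
    2[n+1]≤W = ≤-trans (*-monoˡ-≤-nonNeg (+ 2) (i<j⇒suc[i]≤j n<c+1)) (≤-reflexive (lemma c))
      where lemma : ∀ c → + 2 * (c + 1ℤ) ≡ + 2 * c + + 2
            lemma = solve-∀
    asc : ∀ e → tentExcessΔ e W n ≡ rise e (+ n)
    asc e = tentExcessΔ-ascending e W n 2[n+1]≤W
... | no n≮c+1 =
  (λ odd → subst₂ _≤_ (sym (desc d)) (sym (desc d′))
     (neg-mono-≤ (rise-even adj (c - i) (trans (cong h (odd⇒≡2i+1 n odd)) (lemma₁ c i))))) ,
  (λ even → subst₂ _≤_ (sym (desc d′)) (sym (desc d))
     (neg-mono-≤ (rise-odd adj (c - i) (trans (cong h (even⇒≡2i n even)) (lemma₂ c i)))))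
  where
    W i : ℤ
    W = + 2 * c + + 2
    i = + (n ℕ./ 2)
    h : ℤ → ℤ
    h x = W - (1ℤ + x)
    W≤2n : W ≤ + 2 * + n
    W≤2n = ≤-trans (≤-reflexive (lemma c)) (*-monoˡ-≤-nonNeg (+ 2) (≮⇒≥ n≮c+1))
      where lemma : ∀ c → + 2 * c + + 2 ≡ + 2 * (c + 1ℤ)
            lemma = solve-∀
    desc : ∀ e → tentExcessΔ e W n ≡ - rise e (h (+ n))
    desc e = tentExcessΔ-descending e W n W≤2n
    lemma₁ : ∀ c i → + 2 * c + + 2 - (1ℤ + (+ 2 * i + 1ℤ)) ≡ + 2 * (c - i)
    lemma₁ = solve-∀
    lemma₂ : ∀ c i → + 2 * c + + 2 - (1ℤ + + 2 * i) ≡ + 2 * (c - i) + 1ℤ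
    lemma₂ = solve-∀

oddAdjacent-sandwich : ∀ {u v w z} → u ≤ v → v ≤ w → w ≤ z → z ≤ 1ℤ + u →
                       OddAdjacent (v + w + + 2) (u + z + + 2)
oddAdjacent-sandwich {u} {v} {w} {z} u≤v v≤w w≤z z≤1+u = record { odd-≤ = odd-≤ ; even-≤ = even-≤ }
  where
    open ≤-Reasoning
    odd-≤ : ∀ i → v + w + + 2 ≤ + 2 * i + 1ℤ → u + z + + 2 ≤ + 2 * i + 1ℤ
    odd-≤ i vw≤2i+1 = begin
      u + z + + 2                      ≤⟨ +-monoˡ-≤ (+ 2) (+-mono-≤ u≤v (≤-trans z≤1+u (+-monoʳ-≤ 1ℤ u≤v))) ⟩
      v + (1ℤ + v) + + 2               ≤⟨ +-monoˡ-≤ (+ 2) (+-mono-≤ v≤i-1 (+-monoʳ-≤ 1ℤ v≤i-1)) ⟩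
      i - 1ℤ + (1ℤ + (i - 1ℤ)) + + 2   ≡⟨ lemma i ⟩
      + 2 * i + 1ℤ                     ∎
      where
        v≤i-1 : v ≤ i - 1ℤ
        v≤i-1 = 2*-≤-2*+1⇒≤ v (i - 1ℤ) (≤-via₂ _ _ 0 vw≤2i+1 v≤w (lemma′ v w i))
          where lemma′ : ∀ v w i → + 2 * (i - 1ℤ) + 1ℤ ≡ + 2 * v + (+ 2 * i + 1ℤ - (v + w + + 2)) + (w - v) + + 0
                lemma′ = solve-∀
        lemma : ∀ i → i - 1ℤ + (1ℤ + (i - 1ℤ)) + + 2 ≡ + 2 * i + 1ℤ
        lemma = solve-∀
    even-≤ : ∀ i → u + z + + 2 ≤ + 2 * i → v + w + + 2 ≤ + 2 * i
    even-≤ i uz≤2i with z ≤? u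
    ... | yes z≤u = begin
      v + w + + 2   ≤⟨ +-monoˡ-≤ (+ 2) (+-mono-≤ (≤-trans v≤w w≤z) w≤z) ⟩
      z + z + + 2   ≤⟨ +-monoˡ-≤ (+ 2) (+-monoˡ-≤ z z≤u) ⟩
      u + z + + 2   ≤⟨ uz≤2i ⟩
      + 2 * i       ∎
    ... | no z≰u = begin
      v + w + + 2                         ≤⟨ +-monoˡ-≤ (+ 2) (+-mono-≤ (≤-trans v≤w w≤z) w≤z) ⟩
      z + z + + 2                         ≤⟨ +-monoˡ-≤ (+ 2) (+-mono-≤ z≤1+u z≤1+u) ⟩
      1ℤ + u + (1ℤ + u) + + 2             ≤⟨ +-monoˡ-≤ (+ 2) (+-mono-≤ 1+u≤i-1 1+u≤i-1) ⟩
      i - 1ℤ + (i - 1ℤ) + + 2             ≡⟨ lemma i ⟩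
      + 2 * i                             ∎
      where
        1+u≤i-1 : 1ℤ + u ≤ i - 1ℤ
        1+u≤i-1 = 2*-≤-2*+1⇒≤ (1ℤ + u) (i - 1ℤ) (≤-via₂ _ _ 0 uz≤2i (i<j⇒suc[i]≤j (≰⇒> z≰u)) (lemma′ u z i))
          where lemma′ : ∀ u z i → + 2 * (i - 1ℤ) + 1ℤ ≡ + 2 * (1ℤ + u) + (+ 2 * i - (u + z + + 2)) + (z - (1ℤ + u)) + + 0
                lemma′ = solve-∀
        lemma : ∀ i → i - 1ℤ + (i - 1ℤ) + + 2 ≡ + 2 * i
        lemma = solve-∀

if-yes : ∀ {A B : Set} (a? : Dec A) {t e : B} → A → (if ⌊ a? ⌋ then t else e) ≡ t
if-yes (yes _) _ = refl
if-yes (no ¬a) a = contradiction a ¬a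

if-no : ∀ {A B : Set} (a? : Dec A) {t e : B} → ¬ A → (if ⌊ a? ⌋ then t else e) ≡ e
if-no (yes a) ¬a = contradiction a ¬a
if-no (no _) _ = refl

-- p is written 2 + q so that p ∸ 1 reduces to suc q, the form in which the residues ⟪_⟫ compute.
module _ (q k₀ s : ℕ) (2≤k₀ : 2 ℕ.≤ k₀) (k₀≤p : k₀ ℕ.≤ 2 ℕ.+ q)
         (k₀<2s : + k₀ < + 2 * + s) (2s+4≤k₀+p : + 2 * + s + + 4 ≤ + k₀ + + (2 ℕ.+ q)) where

  private
    p A : ℕ
    p = 2 ℕ.+ q
    A = a p k₀ s
    K S Q : ℤ
    K = + k₀
    S = + s
    Q = + q

  a-inS : + A ≡ K - + 2 - + 2 * S + (1ℤ + Q)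
  a-inS = begin
    + ((K - + 2 - + (2 ℕ.* s)) %ℕ suc q)  ≡⟨ cong (λ x → + ((K - + 2 - x) %ℕ suc q)) (pos-* 2 s) ⟩
    + (x %ℕ suc q)                        ≡⟨ %ℕ-unique (suc q) -1ℤ lower upper ⟩
    x - -1ℤ * (1ℤ + Q)                    ≡⟨ lemma x Q ⟩
    x + (1ℤ + Q)                          ∎
    where
      open ≡-Reasoning
      x : ℤ
      x = K - + 2 - + 2 * S
      lemma : ∀ x Q → x - -1ℤ * (1ℤ + Q) ≡ x + (1ℤ + Q)
      lemma = solve-∀
      lower : -1ℤ * (1ℤ + Q) ≤ x
      lower = ≤-via _ _ 1 2s+4≤k₀+p (lemma′ K S Q)
        where lemma′ : ∀ K S Q → K - + 2 - + 2 * S ≡ -1ℤ * (1ℤ + Q) + (K + (+ 2 + Q) - (+ 2 * S + + 4)) + + 1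
              lemma′ = solve-∀
      upper : x < (1ℤ + -1ℤ) * (1ℤ + Q)
      upper = <-via _ _ 2 (i<j⇒suc[i]≤j k₀<2s) (lemma′ K S Q)
        where lemma′ : ∀ K S Q → (1ℤ + -1ℤ) * (1ℤ + Q) ≡ 1ℤ + (K - + 2 - + 2 * S) + (+ 2 * S - (1ℤ + K)) + + 2
              lemma′ = solve-∀

  private
    F : ℤ → ℤ
    F x = x /ℕ suc p

  dUr-inS-small : ∀ k → A ℕ.+ s ℕ.< suc q →
                  dUr p k₀ k s ≡ F (kBullet p k₀ k - (1ℤ + S)) + F (kBullet p k₀ k - K + (1ℤ + S)) + + 2
  dUr-inS-small k a+s<p-1 = begin
    F (kb - + t₁ p k₀ s) + F (kb - + t₂ p k₀ s) + + 2 + + δ p k₀ s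
      ≡⟨ cong₂ (λ t u → F (kb - + t) + F (kb - + u) + + 2 + + δ p k₀ s) t₁≡ t₂≡ ⟩
    F (kb - (S + + δ p k₀ s)) + F (kb - (+ A + S + + δ p k₀ s + + 2)) + + 2 + + δ p k₀ s
      ≡⟨ cong (λ e → F (kb - (S + + e)) + F (kb - (+ A + S + + e + + 2)) + + 2 + + e) δ≡1 ⟩
    F (kb - (S + 1ℤ)) + F (kb - (+ A + S + 1ℤ + + 2)) + + 2 + 1ℤ
      ≡⟨ cong (λ x → F (kb - (S + 1ℤ)) + F (kb - (x + S + 1ℤ + + 2)) + + 2 + 1ℤ) a-inS ⟩
    F (kb - (S + 1ℤ)) + F (kb - (K - + 2 - + 2 * S + (1ℤ + Q) + S + 1ℤ + + 2)) + + 2 + 1ℤ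
      ≡⟨ cong₂ (λ x y → F x + F y + + 2 + 1ℤ) (lemma₁ kb S) (lemma₂ kb K S Q) ⟩
    F X + F (Y - + suc p) + + 2 + 1ℤ
      ≡⟨ cong (λ y → F X + y + + 2 + 1ℤ) ([z-d]/ℕd≡z/ℕd-1 (suc p) Y) ⟩
    F X + (F Y - 1ℤ) + + 2 + 1ℤ
      ≡⟨ lemma₃ (F X) (F Y) ⟩
    F X + F Y + + 2 ∎
    where
      open ≡-Reasoning
      kb X Y : ℤ
      kb = kBullet p k₀ k
      X = kb - (1ℤ + S)
      Y = kb - K + (1ℤ + S)
      t₁≡ : t₁ p k₀ s ≡ s ℕ.+ δ p k₀ s
      t₁≡ = if-yes (A ℕ.+ s ℕ.<? suc q) a+s<p-1
      t₂≡ : t₂ p k₀ s ≡ A ℕ.+ s ℕ.+ δ p k₀ s ℕ.+ 2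
      t₂≡ = if-yes (A ℕ.+ s ℕ.<? suc q) a+s<p-1
      δ≡1 : δ p k₀ s ≡ 1
      δ≡1 = if-no (s ℕ.+ (A ℕ.+ s) ℕ.% suc q ℕ.<? suc q) (ℕ.≤⇒≯
        (subst (λ r → suc q ℕ.≤ s ℕ.+ r) (sym (ℕ.m<n⇒m%n≡m a+s<p-1)) (drop‿+≤+ p-1≤s+a+s)))
        where
          p-1≤s+a+s : 1ℤ + Q ≤ S + (+ A + S)
          p-1≤s+a+s = ≤-via _ _ 0 (+≤+ 2≤k₀) (trans (cong (λ x → S + (x + S)) a-inS) (lemma K S Q))
            where lemma : ∀ K S Q → S + (K - + 2 - + 2 * S + (1ℤ + Q) + S) ≡ 1ℤ + Q + (K - + 2) + + 0
                  lemma = solve-∀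
      lemma₁ : ∀ kb S → kb - (S + 1ℤ) ≡ kb - (1ℤ + S)
      lemma₁ = solve-∀
      lemma₂ : ∀ kb K S Q → kb - (K - + 2 - + 2 * S + (1ℤ + Q) + S + 1ℤ + + 2) ≡ kb - K + (1ℤ + S) - (+ 3 + Q)
      lemma₂ = solve-∀
      lemma₃ : ∀ x y → x + (y - 1ℤ) + + 2 + 1ℤ ≡ x + y + + 2
      lemma₃ = solve-∀

  dUr-inS-large : ∀ k → ¬ A ℕ.+ s ℕ.< suc q →
                  dUr p k₀ k s ≡ F (kBullet p k₀ k - (1ℤ + S)) + F (kBullet p k₀ k - K + (1ℤ + S)) + + 2
  dUr-inS-large k a+s≮p-1 = begin
    F (kb - + t₁ p k₀ s) + F (kb - + t₂ p k₀ s) + + 2 + + δ p k₀ s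
      ≡⟨ cong₂ (λ t u → F (kb - + t) + F (kb - + u) + + 2 + + δ p k₀ s) t₁≡ t₂≡ ⟩
    F (kb - (+ r + + δ p k₀ s + 1ℤ)) + F (kb - (S + + δ p k₀ s + 1ℤ)) + + 2 + + δ p k₀ s
      ≡⟨ cong (λ e → F (kb - (+ r + + e + 1ℤ)) + F (kb - (S + + e + 1ℤ)) + + 2 + + e) δ≡0 ⟩
    F (kb - (+ r + 0ℤ + 1ℤ)) + F (kb - (S + 0ℤ + 1ℤ)) + + 2 + 0ℤ
      ≡⟨ cong (λ x → F (kb - (x + 0ℤ + 1ℤ)) + F (kb - (S + 0ℤ + 1ℤ)) + + 2 + 0ℤ) r≡ ⟩
    F (kb - (K - + 2 - S + 0ℤ + 1ℤ)) + F (kb - (S + 0ℤ + 1ℤ)) + + 2 + 0ℤ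
      ≡⟨ cong₂ (λ x y → F x + F y + + 2 + 0ℤ) (lemma₁ kb K S) (lemma₂ kb S) ⟩
    F Y + F X + + 2 + 0ℤ
      ≡⟨ lemma₃ (F X) (F Y) ⟩
    F X + F Y + + 2 ∎
    where
      open ≡-Reasoning
      kb X Y : ℤ
      kb = kBullet p k₀ k
      X = kb - (1ℤ + S)
      Y = kb - K + (1ℤ + S)
      r : ℕ
      r = (A ℕ.+ s) ℕ.% suc q
      t₁≡ : t₁ p k₀ s ≡ r ℕ.+ δ p k₀ s ℕ.+ 1
      t₁≡ = if-no (A ℕ.+ s ℕ.<? suc q) a+s≮p-1
      t₂≡ : t₂ p k₀ s ≡ s ℕ.+ δ p k₀ s ℕ.+ 1
      t₂≡ = if-no (A ℕ.+ s ℕ.<? suc q) a+s≮p-1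
      r≡ : + r ≡ K - + 2 - S
      r≡ = trans (%ℕ-unique (suc q) 1ℤ lower upper)
                 (trans (cong (λ x → x + S - 1ℤ * (1ℤ + Q)) a-inS) (lemma K S Q))
        where
          lemma : ∀ K S Q → K - + 2 - + 2 * S + (1ℤ + Q) + S - 1ℤ * (1ℤ + Q) ≡ K - + 2 - S
          lemma = solve-∀
          lower : 1ℤ * (1ℤ + Q) ≤ + A + S
          lower = subst (_≤ + A + S) (sym (*-identityˡ (1ℤ + Q))) (+≤+ (ℕ.≮⇒≥ a+s≮p-1))
          upper : + A + S < (1ℤ + 1ℤ) * (1ℤ + Q)
          upper = suc[i]≤j⇒i<j (≤-via₂ _ _ 0 (+≤+ k₀≤p) (+≤+ (z≤n {s}))
            (trans (lemma′ K S Q) (cong (λ x → 1ℤ + (x + S) + (+ 2 + Q - K) + (S - 0ℤ) + + 0) (sym a-inS))))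
            where lemma′ : ∀ K S Q → (1ℤ + 1ℤ) * (1ℤ + Q) ≡ 1ℤ + (K - + 2 - + 2 * S + (1ℤ + Q) + S) + (+ 2 + Q - K) + (S - 0ℤ) + + 0
                  lemma′ = solve-∀
      δ≡0 : δ p k₀ s ≡ 0
      δ≡0 = if-yes (s ℕ.+ r ℕ.<? suc q)
        (drop‿+<+ (subst (λ x → S + x < 1ℤ + Q) (sym r≡) (<-via _ _ 0 (+≤+ k₀≤p) (lemma K S Q))))
        where lemma : ∀ K S Q → 1ℤ + Q ≡ 1ℤ + (S + (K - + 2 - S)) + (+ 2 + Q - K) + + 0
              lemma = solve-∀
      lemma₁ : ∀ kb K S → kb - (K - + 2 - S + 0ℤ + 1ℤ) ≡ kb - K + (1ℤ + S)
      lemma₁ = solve-∀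
      lemma₂ : ∀ kb S → kb - (S + 0ℤ + 1ℤ) ≡ kb - (1ℤ + S)
      lemma₂ = solve-∀
      lemma₃ : ∀ x y → y + x + + 2 + 0ℤ ≡ x + y + + 2
      lemma₃ = solve-∀

  dUr-inS : ∀ k → dUr p k₀ k s ≡ F (kBullet p k₀ k - (1ℤ + S)) + F (kBullet p k₀ k - K + (1ℤ + S)) + + 2
  dUr-inS k = [ dUr-inS-small k , dUr-inS-large k ]′ (toSum (A ℕ.+ s ℕ.<? suc q))

Smin≤s⇒k₀<2s : ∀ p k₀ {s} → Smin p k₀ ℕ.≤ s → + k₀ < + 2 * + s
Smin≤s⇒k₀<2s p k₀ {s} Smin≤s =
  subst (+ k₀ <_) (trans (pos-* s 2) (*-comm (+ s) (+ 2))) (+<+ (ℕ.≤-pred (begin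
    2 ℕ.+ k₀                               ≡⟨ ℕ.+-comm 2 k₀ ⟩
    k₀ ℕ.+ 2                               ≡⟨ ℕ.m≡m%n+[m/n]*n (k₀ ℕ.+ 2) 2 ⟩
    (k₀ ℕ.+ 2) ℕ.% 2 ℕ.+ Smin p k₀ ℕ.* 2   ≤⟨ ℕ.+-mono-≤ (ℕ.≤-pred (ℕ.m%n<n (k₀ ℕ.+ 2) 2)) (ℕ.*-monoˡ-≤ 2 Smin≤s) ⟩
    1 ℕ.+ s ℕ.* 2                          ∎)))
  where open ℕ.≤-Reasoning

s≤Smax⇒2s+4≤k₀+p : ∀ p k₀ {s} → 4 ℕ.≤ k₀ ℕ.+ p → s ℕ.≤ Smax p k₀ → + 2 * + s + + 4 ≤ + k₀ + + p
s≤Smax⇒2s+4≤k₀+p p k₀ {s} 4≤k₀+p s≤Smax =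
  subst (λ x → x + + 4 ≤ + k₀ + + p) (trans (pos-* s 2) (*-comm (+ s) (+ 2))) (+≤+ (begin
    s ℕ.* 2 ℕ.+ 4                ≤⟨ ℕ.+-monoˡ-≤ 4 (ℕ.*-monoˡ-≤ 2 s≤Smax) ⟩
    Smax p k₀ ℕ.* 2 ℕ.+ 4        ≤⟨ ℕ.+-monoˡ-≤ 4 (ℕ.m/n*n≤m (k₀ ℕ.+ p ℕ.∸ 4) 2) ⟩
    k₀ ℕ.+ p ℕ.∸ 4 ℕ.+ 4         ≡⟨ ℕ.m∸n+n≡m 4≤k₀+p ⟩
    k₀ ℕ.+ p                     ∎))
  where open ℕ.≤-Reasoning

dUr-oddAdjacent : ∀ q k₀ {s s′} k → 2 ℕ.≤ k₀ → k₀ ℕ.≤ 2 ℕ.+ q →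
                  + k₀ < + 2 * + s → s ℕ.< s′ → + 2 * + s′ + + 4 ≤ + k₀ + + (2 ℕ.+ q) →
                  OddAdjacent (dUr (2 ℕ.+ q) k₀ k s) (dUr (2 ℕ.+ q) k₀ k s′)
dUr-oddAdjacent q k₀ {s} {s′} k 2≤k₀ k₀≤p k₀<2s s<s′ 2s′+4≤k₀+p =
  subst₂ OddAdjacent
    (sym (dUr-inS q k₀ s 2≤k₀ k₀≤p k₀<2s 2s+4≤k₀+p k))
    (sym (dUr-inS q k₀ s′ 2≤k₀ k₀≤p k₀<2s′ 2s′+4≤k₀+p k))
    (oddAdjacent-sandwich (/ℕ-mono-≤ (3 ℕ.+ q) X′≤X) (/ℕ-mono-≤ (3 ℕ.+ q) X≤Y)
                          (/ℕ-mono-≤ (3 ℕ.+ q) Y≤Y′) (/ℕ-≤-suc (3 ℕ.+ q) {X′} Y′<X′+p+1))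
  where
    kb K S S′ Q : ℤ
    kb = kBullet (2 ℕ.+ q) k₀ k
    K = + k₀
    S = + s
    S′ = + s′
    Q = + q
    1+s≤s′ : 1ℤ + S ≤ S′
    1+s≤s′ = i<j⇒suc[i]≤j (+<+ s<s′)
    2s+4≤k₀+p : + 2 * S + + 4 ≤ K + (+ 2 + Q)
    2s+4≤k₀+p = ≤-trans (+-monoˡ-≤ (+ 4) (*-monoˡ-≤-nonNeg (+ 2) (+≤+ (ℕ.<⇒≤ s<s′)))) 2s′+4≤k₀+p
    k₀<2s′ : K < + 2 * S′
    k₀<2s′ = <-≤-trans k₀<2s (*-monoˡ-≤-nonNeg (+ 2) (+≤+ (ℕ.<⇒≤ s<s′)))
    X X′ Y Y′ : ℤ
    X = kb - (1ℤ + S)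
    X′ = kb - (1ℤ + S′)
    Y = kb - K + (1ℤ + S)
    Y′ = kb - K + (1ℤ + S′)
    X′≤X : X′ ≤ X
    X′≤X = ≤-via _ _ 1 1+s≤s′ (lemma kb S S′)
      where lemma : ∀ kb S S′ → kb - (1ℤ + S) ≡ kb - (1ℤ + S′) + (S′ - (1ℤ + S)) + + 1
            lemma = solve-∀
    X≤Y : X ≤ Y
    X≤Y = ≤-via _ _ 3 (i<j⇒suc[i]≤j k₀<2s) (lemma kb K S)
      where lemma : ∀ kb K S → kb - K + (1ℤ + S) ≡ kb - (1ℤ + S) + (+ 2 * S - (1ℤ + K)) + + 3
            lemma = solve-∀
    Y≤Y′ : Y ≤ Y′
    Y≤Y′ = ≤-via _ _ 1 1+s≤s′ (lemma kb K S S′)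
      where lemma : ∀ kb K S S′ → kb - K + (1ℤ + S′) ≡ kb - K + (1ℤ + S) + (S′ - (1ℤ + S)) + + 1
            lemma = solve-∀
    Y′<X′+p+1 : Y′ < X′ + (+ 3 + Q)
    Y′<X′+p+1 = <-via _ _ 2 2s′+4≤k₀+p (lemma kb K S′ Q)
      where lemma : ∀ kb K S′ Q → kb - (1ℤ + S′) + (+ 3 + Q) ≡ 1ℤ + (kb - K + (1ℤ + S′)) + (K + (+ 2 + Q) - (+ 2 * S′ + + 4)) + + 2
            lemma = solve-∀

-- The hypotheses that p is prime, k ≥ 2 and p − 1 ∣ k − k₀ are unused: the inequalities hold for every integer k.
lemma3p21 : (p k₀ : ℕ) → Prime p → 7 ℕ.≤ p → 2 ℕ.≤ k₀ → k₀ ℕ.≤ p →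
            (k : ℤ) → + 2 ≤ k → + (p ℕ.∸ 1) ∣ℤ (k - + k₀) →
            (n s s′ : ℕ) →
            Smin p k₀ ℕ.≤ s → s ℕ.< s′ → s′ ℕ.≤ Smax p k₀ →
            (n ℕ.% 2 ≡ 1 →
               m p k₀ s k (suc n) - m p k₀ s k n ≤ m p k₀ s′ k (suc n) - m p k₀ s′ k n)
            × (n ℕ.% 2 ≡ 0 →
               m p k₀ s′ k (suc n) - m p k₀ s′ k n ≤ m p k₀ s k (suc n) - m p k₀ s k n)
lemma3p21 p@(suc (suc q)) k₀ _ 7≤p 2≤k₀ k₀≤p k _ _ n s s′ Smin≤s s<s′ s′≤Smax =
  tentExcessΔ-compare (kBullet p k₀ k) n
    (dUr-oddAdjacent q k₀ k 2≤k₀ k₀≤p (Smin≤s⇒k₀<2s p k₀ Smin≤s) s<s′ (s≤Smax⇒2s+4≤k₀+p p k₀ 4≤k₀+p s′≤Smax))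
  where
    4≤k₀+p : 4 ℕ.≤ k₀ ℕ.+ p
    4≤k₀+p = ℕ.≤-trans (ℕ.≤-trans (ℕ.m≤m+n 4 3) 7≤p) (ℕ.m≤n+m p k₀)
lemma3p21 (suc zero) _ _ (s≤s ())
lemma3p21 zero _ _ ()
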